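{- Let $G$ be a group and let $H$ be a normal subgroup of $G$ of finite index. Let $X \subset G$ be a set of coset representatives for $H$ in $G$ (so $X$ contains exactly one element of each coset of $H$). Define \[ C(X)=\frac{|\{(x,y)\in X\times X : xy\in X\}|}{|X|^2}. \] If $C(X)>7/9$, then there is a subgroup $K$ of $G$ with $HK=G$ and $H\cap K=\{1\}$.
   Context: $C(X)$ is the proportion of ordered pairs $(x,y)\in X\times X$ for which no (non-trivial) carry occurs, i.e. for which the product $xy$ is again one of the chosen coset representatives. -}

module Defs where

open import Level using (Level; _⊔_)
open import Data.Nat using (ℕ; _*_; _<_)
open import Data.Fin using (Fin)
open import Data.Product using (Σ; ∃; _×_; _,_; proj₁; proj₂)
open import Data.List using (List; length)
open import Data.List.Relation.Unary.All using (All)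
open import Data.List.Relation.Unary.Unique.Propositional using (Unique)
open import Relation.Binary.PropositionalEquality using (_≡_)
open import Relation.Unary using (Pred)
open import Algebra.Bundles using (Group)

module _ {c ℓ : Level} (G : Group c ℓ) where
  open Group G

  record IsSubgroup {p : Level} (P : Pred Carrier p) : Set (c ⊔ ℓ ⊔ p) where
    field
      resp  : ∀ {x y} → x ≈ y → P x → P y
      ε∈    : P ε
      ∙-closed : ∀ {x y} → P x → P y → P (x ∙ y)
      ⁻¹-closed : ∀ {x} → P x → P (x ⁻¹)

  record IsNormalSubgroup {p : Level} (P : Pred Carrier p) : Set (c ⊔ ℓ ⊔ p) where
    field
      subgroup : IsSubgroup P
      conj-closed : ∀ g {h} → P h → P ((g ∙ h) ∙ g ⁻¹)

  -- X : Fin n → G is a (complete, irredundant) set of coset representatives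
  -- for H in G: every coset gH contains some X i, and distinct indices lie in
  -- distinct cosets. (Hence H has finite index n and |X| = n.)
  record IsCosetReps {p : Level} (H : Pred Carrier p) (n : ℕ) (X : Fin n → Carrier)
         : Set (c ⊔ ℓ ⊔ p) where
    field
      covers   : ∀ g → ∃ λ i → H (X i ⁻¹ ∙ g)
      distinct : ∀ i j → H (X i ⁻¹ ∙ X j) → i ≡ j

  InImage : {n : ℕ} → (Fin n → Carrier) → Pred Carrier (ℓ)
  InImage {n} X g = ∃ λ i → g ≈ X i

  -- C(X) > 7/9, i.e. |{(x,y) ∈ X×X : xy ∈ X}| > (7/9)|X|²:
  -- there is a list of pairwise distinct index pairs (i,j), each with
  -- X i ∙ X j ∈ X, whose length L satisfies 9 L > 7 n².
  CarryFreeAbove7/9 : {n : ℕ} → (Fin n → Carrier) → Set ℓ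
  CarryFreeAbove7/9 {n} X =
    Σ (List (Fin n × Fin n)) λ S →
      Unique S × All (λ ij → InImage X (X (proj₁ ij) ∙ X (proj₂ ij))) S
               × (7 * (n * n) < 9 * length S)

  record IsComplement {p k : Level} (H : Pred Carrier p) (K : Pred Carrier k)
         : Set (c ⊔ ℓ ⊔ p ⊔ k) where
    field
      subgroup : IsSubgroup K
      HK=G     : ∀ g → Σ Carrier λ h → Σ Carrier λ x → H h × K x × (g ≈ h ∙ x)
      H∩K=1    : ∀ g → H g → K g → g ≈ ε

-- Index G/H by Fin n through the transversal X and let t(a, x) = X(ax) X(x)⁻¹ (factor a x
-- below), an element of the coset X(a)H.  These satisfy the cocycle identity
-- t(a, bx) t(b, x) = t(ab, x), and t(a, vy) = t(a, v) whenever neither X(v)X(y) nor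
-- X(av)X(y) carries.  For fixed a, join v to u when both products with y = v⁻¹u are
-- carry-free.  Since C(X) > 7/9 this graph has more than 5n²/9 edges, so a vertex of maximal
-- degree together with the vertices sharing a neighbour with it is a set of more than 2n/3
-- points x on which t(a, x) takes a single value s(a).  Any three such sets meet, so the
-- cocycle identity gives s(a)s(b) = s(ab), and the image of s is a complement of H.
module Submission where

open import Level using (_⊔_; Lift; lift)
open import Function using (_∘_; id)
open import Function.Bundles using (Equivalence)
open import Data.Empty using (⊥; ⊥-elim)
open import Data.Unit using (tt)
open import Data.Bool using (Bool; true; false; T; _∧_; _∨_; not)
open import Data.Bool.Properties using (T-∧; T?)
open import Data.Nat using (ℕ; zero; suc; _+_; _*_; _≤_; _<_; z≤n; s≤s)
open import Data.Nat.Properties hiding (_≟_)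
open import Data.Nat.Tactic.RingSolver using (solve-∀)
open import Data.Fin using (Fin; zero; suc)
import Data.Fin.Properties as Fin
open import Data.Fin.Permutation using (Permutation; permutation; flip; _⟨$⟩ʳ_)
open import Data.Product using (Σ; ∃; _×_; _,_; proj₁; proj₂)
import Data.Product as Prod
open import Data.Product.Properties using (≡-dec)
open import Data.Sum using (_⊎_; inj₁; inj₂; [_,_]′)
open import Data.List using (List; []; _∷_; length; allFin)
open import Data.List.Relation.Unary.All as All using (All)
open import Data.List.Relation.Unary.All.Properties using (All¬⇒¬Any)
open import Data.List.Relation.Unary.AllPairs using (_∷_)
open import Data.List.Relation.Unary.Unique.Propositional using (Unique)
open import Data.List.Membership.Propositional.Properties using (∈-allFin)
import Data.List.Membership.DecPropositional as DecMembership
open import Data.List.Extrema.Nat using (argmax; f[xs]≤f[argmax])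
open import Relation.Nullary using (¬_; Dec; yes; no; does; _×-dec_)
open import Relation.Nullary.Decidable using (dec-true)
open import Relation.Binary.Definitions using (DecidableEquality)
open import Relation.Binary.Structures using (IsEquivalence)
open import Relation.Binary.PropositionalEquality as ≡ using (_≡_; cong; cong₂; subst; subst₂)
import Relation.Binary.Reasoning.Setoid as SetoidReasoning
open import Relation.Binary.Reasoning.Syntax using (module ≈-syntax)
open import Relation.Unary using (Pred)
open import Algebra.Bundles using (Group)
import Algebra.Properties.Group as GroupProperties
open import Algebra.Properties.Semiring.Sum +-*-semiring
  using (sum; sum-syntax; sum-cong-≗; ∑-distrib-+; sum-permute; *-distribʳ-sum)

open import Defs

pn+nq≤pq+nn : ∀ {n p q} → n ≤ p → n ≤ q → p * n + n * q ≤ p * q + n * n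
pn+nq≤pq+nn {n} n≤p n≤q with m≤n⇒∃[o]m+o≡n n≤p | m≤n⇒∃[o]m+o≡n n≤q
... | x , ≡.refl | y , ≡.refl = begin
  (n + x) * n + n * (n + y)               ≤⟨ m≤m+n _ (x * y) ⟩
  (n + x) * n + n * (n + y) + x * y       ≡⟨ e n x y ⟩
  (n + x) * (n + y) + n * n               ∎
  where
  open ≤-Reasoning
  e : ∀ n x y → (n + x) * n + n * (n + y) + x * y ≡ (n + x) * (n + y) + n * n
  e = solve-∀

-- With c' = n − c ≥ n/3 and d ≥ n/2 one has c d + c' (n − d) = n d − c' (2d − n)
-- ≤ n d − n (2d − n)/3 = (n d + n²)/3, which is at most 5n²/9 once 3d ≤ 2n.
cluster-bound : ∀ {n T d c c'} → c + c' ≡ n → 5 * (n * n) < 9 * T → T ≤ n * d →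
                T + c' * d ≤ c * d + c' * n → 2 * n < 3 * d ⊎ 2 * n < 3 * c
cluster-bound {n} {T} {d} {c} {c'} ≡.refl 5n²<9T T≤nd T+c'd≤cd+c'n with 2 * n <? 3 * d | 2 * n <? 3 * c
... | yes 2n<3d | _         = inj₁ 2n<3d
... | no _      | yes 2n<3c = inj₂ 2n<3c
... | no 2n≮3d  | no 2n≮3c  = ⊥-elim (<⇒≱ 5n²<9T 9T≤5n²)
  where
  open ≤-Reasoning
  5n<9d : 5 * n < 9 * d
  5n<9d = *-cancelʳ-< n (5 * n) (9 * d) (begin-strict
    5 * n * n     ≡⟨ *-assoc 5 n n ⟩
    5 * (n * n)   <⟨ 5n²<9T ⟩
    9 * T         ≤⟨ *-monoʳ-≤ 9 T≤nd ⟩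
    9 * (n * d)   ≡⟨ e₁ n d ⟩
    9 * d * n     ∎)
    where
    e₁ : ∀ n d → 9 * (n * d) ≡ 9 * d * n
    e₁ = solve-∀
  n≤2d : n ≤ 2 * d
  n≤2d = <⇒≤ (*-cancelˡ-< 9 n (2 * d) (begin-strict
    9 * n         ≤⟨ *-monoˡ-≤ n (n≤1+n 9) ⟩
    10 * n        ≡⟨ *-assoc 2 5 n ⟩
    2 * (5 * n)   <⟨ *-monoʳ-< 2 5n<9d ⟩
    2 * (9 * d)   ≡⟨ e₂ d ⟩
    9 * (2 * d)   ∎))
    where
    e₂ : ∀ d → 2 * (9 * d) ≡ 9 * (2 * d)
    e₂ = solve-∀
  n≤3c' : n ≤ 3 * c'
  n≤3c' = +-cancelˡ-≤ (2 * n) n (3 * c') (begin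
    2 * n + n        ≡⟨ e₃ c c' ⟩
    3 * c + 3 * c'   ≤⟨ +-monoˡ-≤ (3 * c') (≮⇒≥ 2n≮3c) ⟩
    2 * n + 3 * c'   ∎)
    where
    e₃ : ∀ c c' → 2 * (c + c') + (c + c') ≡ 3 * c + 3 * c'
    e₃ = solve-∀
  R : ℕ
  R = 6 * (n * d) + 9 * (c' * d) + 9 * (c' * n)
  9T≤5n² : 9 * T ≤ 5 * (n * n)
  9T≤5n² = begin
    9 * T                          ≤⟨ +-cancelʳ-≤ R (9 * T) _ key ⟩
    3 * (n * d) + 3 * (n * n)      ≤⟨ +-monoˡ-≤ (3 * (n * n)) 3nd≤2nn ⟩
    2 * (n * n) + 3 * (n * n)      ≡⟨ *-distribʳ-+ (n * n) 2 3 ⟨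
    5 * (n * n)                    ∎
    where
    key : 9 * T + R ≤ (3 * (n * d) + 3 * (n * n)) + R
    key = begin
      9 * T + R                                               ≡⟨ e₄ T c c' d ⟩
      9 * (T + c' * d) + 3 * (3 * c' * n + n * (2 * d))       ≤⟨ +-mono-≤ (*-monoʳ-≤ 9 T+c'd≤cd+c'n)
                                                                          (*-monoʳ-≤ 3 (pn+nq≤pq+nn n≤3c' n≤2d)) ⟩
      9 * (c * d + c' * n) + 3 * (3 * c' * (2 * d) + n * n)   ≡⟨ e₅ c c' d ⟩
      (3 * (n * d) + 3 * (n * n)) + R                         ∎
      where
      e₄ : ∀ T c c' d → let n = c + c' in
           9 * T + (6 * (n * d) + 9 * (c' * d) + 9 * (c' * n)) ≡ 9 * (T + c' * d) + 3 * (3 * c' * n + n * (2 * d))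
      e₄ = solve-∀
      e₅ : ∀ c c' d → let n = c + c' in
           9 * (c * d + c' * n) + 3 * (3 * c' * (2 * d) + n * n) ≡ (3 * (n * d) + 3 * (n * n)) + (6 * (n * d) + 9 * (c' * d) + 9 * (c' * n))
      e₅ = solve-∀
    3nd≤2nn : 3 * (n * d) ≤ 2 * (n * n)
    3nd≤2nn = begin
      3 * (n * d)   ≡⟨ e₆ n d ⟩
      n * (3 * d)   ≤⟨ *-monoʳ-≤ n (≮⇒≥ 2n≮3d) ⟩
      n * (2 * n)   ≡⟨ e₆' n ⟩
      2 * (n * n)   ∎
      where
      e₆ : ∀ n d → 3 * (n * d) ≡ n * (3 * d)
      e₆ = solve-∀
      e₆' : ∀ n → n * (2 * n) ≡ 2 * (n * n)
      e₆' = solve-∀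

>⅔-thrice⇒0< : ∀ {n a b c x} → 2 * n < 3 * a → 2 * n < 3 * b → 2 * n < 3 * c →
               a + (b + c) ≤ x + (n + n) → 0 < x
>⅔-thrice⇒0< {x = suc x} _ _ _ _ = s≤s z≤n
>⅔-thrice⇒0< {n} {a} {b} {c} {zero} 2n<3a 2n<3b 2n<3c a+b+c≤2n =
  ⊥-elim (<⇒≱ (*-cancelˡ-< 3 (n + n) (a + (b + c)) 6n<3[a+b+c]) a+b+c≤2n)
  where
  6n<3[a+b+c] : 3 * (n + n) < 3 * (a + (b + c))
  6n<3[a+b+c] = subst₂ _<_ (lhs n) (rhs a b c) (+-mono-< 2n<3a (+-mono-< 2n<3b 2n<3c))
    where
    lhs : ∀ n → 2 * n + (2 * n + 2 * n) ≡ 3 * (n + n)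
    lhs = solve-∀
    rhs : ∀ a b c → 3 * a + (3 * b + 3 * c) ≡ 3 * (a + (b + c))
    rhs = solve-∀

7/9-twice⇒5/9 : ∀ {N L E} → 7 * N < 9 * L → L + L ≤ E + N → 5 * N < 9 * E
7/9-twice⇒5/9 {N} {L} {E} 7N<9L 2L≤E+N = +-cancelʳ-< (9 * N) (5 * N) (9 * E) (begin-strict
  5 * N + 9 * N     ≡⟨ e₁ N ⟩
  2 * (7 * N)       <⟨ *-monoʳ-< 2 7N<9L ⟩
  2 * (9 * L)       ≡⟨ e₂ L ⟩
  9 * (L + L)       ≤⟨ *-monoʳ-≤ 9 2L≤E+N ⟩
  9 * (E + N)       ≡⟨ *-distribˡ-+ 9 E N ⟩
  9 * E + 9 * N     ∎)
  where
  open ≤-Reasoning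
  e₁ : ∀ N → 5 * N + 9 * N ≡ 2 * (7 * N)
  e₁ = solve-∀
  e₂ : ∀ L → 2 * (9 * L) ≡ 9 * (L + L)
  e₂ = solve-∀

sum-mono-≤ : ∀ {n} {f g : Fin n → ℕ} → (∀ i → f i ≤ g i) → sum f ≤ sum g
sum-mono-≤ {zero}  f≤g = z≤n
sum-mono-≤ {suc n} f≤g = +-mono-≤ (f≤g zero) (sum-mono-≤ (f≤g ∘ suc))

sum-const : ∀ n k → ∑[ i < n ] k ≡ n * k
sum-const zero    k = ≡.refl
sum-const (suc n) k = cong (k +_) (sum-const n k)

term≤sum : ∀ {n} (f : Fin n → ℕ) i → f i ≤ sum f
term≤sum f zero    = m≤m+n _ _
term≤sum f (suc i) = ≤-trans (term≤sum (f ∘ suc) i) (m≤n+m _ _)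

𝟙 : Bool → ℕ
𝟙 true  = 1
𝟙 false = 0

count : ∀ {n} → (Fin n → Bool) → ℕ
count {n} P = ∑[ i < n ] 𝟙 (P i)

count-permute : ∀ {n} (P : Fin n → Bool) (π : Permutation n n) →
                count (P ∘ (π ⟨$⟩ʳ_)) ≡ count P
count-permute P π = ≡.sym (sum-permute (𝟙 ∘ P) π)

count>0⇒∃ : ∀ {n} (P : Fin n → Bool) → 0 < count P → ∃ λ i → T (P i)
count>0⇒∃ {suc n} P pos with P zero in P₀
... | true  = zero , subst T (≡.sym P₀) tt
... | false = Prod.map suc id (count>0⇒∃ (P ∘ suc) pos)

count-∧ : ∀ {n} (P Q : Fin n → Bool) → count P + count Q ≤ count (λ i → P i ∧ Q i) + n
count-∧ {n} P Q = begin
  count P + count Q                             ≡⟨ ∑-distrib-+ (𝟙 ∘ P) (𝟙 ∘ Q) ⟨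
  ∑[ i < n ] (𝟙 (P i) + 𝟙 (Q i))                ≤⟨ sum-mono-≤ {n} (λ i → 𝟙-∧ (P i) (Q i)) ⟩
  ∑[ i < n ] (𝟙 (P i ∧ Q i) + 1)                ≡⟨ ∑-distrib-+ (λ i → 𝟙 (P i ∧ Q i)) (λ _ → 1) ⟩
  count (λ i → P i ∧ Q i) + ∑[ i < n ] 1        ≡⟨ cong (count (λ i → P i ∧ Q i) +_) (≡.trans (sum-const n 1) (*-identityʳ n)) ⟩
  count (λ i → P i ∧ Q i) + n                   ∎
  where
  open ≤-Reasoning
  𝟙-∧ : ∀ a b → 𝟙 a + 𝟙 b ≤ 𝟙 (a ∧ b) + 1
  𝟙-∧ true  true  = ≤-refl
  𝟙-∧ true  false = ≤-refl
  𝟙-∧ false true  = ≤-refl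
  𝟙-∧ false false = z≤n

count-disjoint : ∀ {n} (P Q : Fin n → Bool) → ¬ (∃ λ i → T (P i) × T (Q i)) → count P + count Q ≤ n
count-disjoint {n} P Q disjoint = ≤-trans (count-∧ P Q) (≤-reflexive (cong (_+ n) |P∧Q|≡0))
  where
  |P∧Q|≡0 : count (λ i → P i ∧ Q i) ≡ 0
  |P∧Q|≡0 = n≤0⇒n≡0 (≮⇒≥ (disjoint ∘ Prod.map₂ (Equivalence.to T-∧) ∘ count>0⇒∃ _))

count-∨ˡ : ∀ {n} (P Q : Fin n → Bool) → count P ≤ count (λ i → P i ∨ Q i)
count-∨ˡ P Q = sum-mono-≤ (λ i → 𝟙-∨ˡ (P i) (Q i))
  where
  𝟙-∨ˡ : ∀ a b → 𝟙 a ≤ 𝟙 (a ∨ b)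
  𝟙-∨ˡ true  b = ≤-refl
  𝟙-∨ˡ false b = z≤n

count-∨ʳ : ∀ {n} (P Q : Fin n → Bool) → count Q ≤ count (λ i → P i ∨ Q i)
count-∨ʳ P Q = sum-mono-≤ (λ i → 𝟙-∨ʳ (P i) (Q i))
  where
  𝟙-∨ʳ : ∀ a b → 𝟙 b ≤ 𝟙 (a ∨ b)
  𝟙-∨ʳ true  true  = ≤-refl
  𝟙-∨ʳ true  false = z≤n
  𝟙-∨ʳ false b     = ≤-refl

count-not : ∀ {n} (P : Fin n → Bool) → count P + count (not ∘ P) ≡ n
count-not {n} P = begin
  count P + count (not ∘ P)               ≡⟨ ∑-distrib-+ (𝟙 ∘ P) (𝟙 ∘ not ∘ P) ⟨
  ∑[ i < n ] (𝟙 (P i) + 𝟙 (not (P i)))    ≡⟨ sum-cong-≗ {n} (𝟙-+-not ∘ P) ⟩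
  ∑[ i < n ] 1                            ≡⟨ sum-const n 1 ⟩
  n * 1                                   ≡⟨ *-identityʳ n ⟩
  n                                       ∎
  where
  open ≡.≡-Reasoning
  𝟙-+-not : ∀ b → 𝟙 b + 𝟙 (not b) ≡ 1
  𝟙-+-not true  = ≡.refl
  𝟙-+-not false = ≡.refl

count-*ʳ : ∀ {n} (P : Fin n → Bool) k → ∑[ i < n ] (𝟙 (P i) * k) ≡ count P * k
count-*ʳ P k = ≡.sym (*-distribʳ-sum k (𝟙 ∘ P))

large-subsets-meet : ∀ {n} (P Q R : Fin n → Bool) →
  2 * n < 3 * count P → 2 * n < 3 * count Q → 2 * n < 3 * count R →
  ∃ λ i → T (P i) × T (Q i) × T (R i)
large-subsets-meet {n} P Q R |P| |Q| |R| =
  Prod.map₂ (λ PQR → let (Pi , QRi) = Equivalence.to T-∧ PQR in Pi , Equivalence.to T-∧ QRi)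
            (count>0⇒∃ (λ i → P i ∧ (Q i ∧ R i))
              (>⅔-thrice⇒0< {n} {count P} {count Q} {count R} {count (λ i → P i ∧ (Q i ∧ R i))} |P| |Q| |R| sum≤))
  where
  open ≤-Reasoning
  sum≤ : count P + (count Q + count R) ≤ count (λ i → P i ∧ (Q i ∧ R i)) + (n + n)
  sum≤ = begin
    count P + (count Q + count R)                        ≤⟨ +-monoʳ-≤ (count P) (count-∧ Q R) ⟩
    count P + (count (λ i → Q i ∧ R i) + n)              ≡⟨ +-assoc (count P) _ n ⟨
    count P + count (λ i → Q i ∧ R i) + n                ≤⟨ +-monoˡ-≤ n (count-∧ P (λ i → Q i ∧ R i)) ⟩
    count (λ i → P i ∧ (Q i ∧ R i)) + n + n              ≡⟨ +-assoc _ n n ⟩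
    count (λ i → P i ∧ (Q i ∧ R i)) + (n + n)            ∎

open module PairMembership {m n : ℕ} = DecMembership (≡-dec (Fin._≟_ {m}) (Fin._≟_ {n}))
  using (_∈?_)

length≤count-∈ : ∀ {m n} {L : List (Fin m × Fin n)} → Unique L →
                 length L ≤ ∑[ i < m ] count (λ j → does ((i , j) ∈? L))
length≤count-∈         {L = []}    _              = z≤n
length≤count-∈ {m} {n} {L = x ∷ L} (x∉L ∷ unique) = begin
  1 + length L
    ≤⟨ +-mono-≤ x-counted (length≤count-∈ unique) ⟩
  ∑[ i < m ] count (λ j → does ((i , j) ≟ x)) + ∑[ i < m ] count (λ j → does ((i , j) ∈? L))
    ≡⟨ ∑-distrib-+ (λ i → count (λ j → does ((i , j) ≟ x))) (λ i → count (λ j → does ((i , j) ∈? L))) ⟨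
  ∑[ i < m ] (count (λ j → does ((i , j) ≟ x)) + count (λ j → does ((i , j) ∈? L)))
    ≡⟨ sum-cong-≗ {m} counts-split ⟩
  ∑[ i < m ] count (λ j → does ((i , j) ∈? x ∷ L)) ∎
  where
  open ≤-Reasoning
  _≟_ : DecidableEquality (Fin m × Fin n)
  _≟_ = ≡-dec Fin._≟_ Fin._≟_
  𝟙-∨ : ∀ a b → (T a → T b → ⊥) → 𝟙 a + 𝟙 b ≡ 𝟙 (a ∨ b)
  𝟙-∨ true  true  a∧b = ⊥-elim (a∧b tt tt)
  𝟙-∨ true  false _   = ≡.refl
  𝟙-∨ false b     _   = ≡.refl
  x∈L-absurd : ∀ q → T (does (q ≟ x)) → T (does (q ∈? L)) → ⊥
  x∈L-absurd q with q ≟ x | q ∈? L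
  ... | yes ≡.refl | yes x∈L = λ _ _ → All¬⇒¬Any x∉L x∈L
  ... | yes _      | no _    = λ _ ()
  ... | no _       | _       = λ ()
  counts-split : ∀ i → count (λ j → does ((i , j) ≟ x)) + count (λ j → does ((i , j) ∈? L))
                     ≡ count (λ j → does ((i , j) ∈? x ∷ L))
  counts-split i = ≡.trans (≡.sym (∑-distrib-+ (λ j → 𝟙 (does ((i , j) ≟ x))) (λ j → 𝟙 (does ((i , j) ∈? L)))))
                           (sum-cong-≗ {n} (λ j → 𝟙-∨ _ _ (x∈L-absurd (i , j))))
  x-counted : 1 ≤ ∑[ i < m ] count (λ j → does ((i , j) ≟ x))
  x-counted = begin
    1                                              ≡⟨ cong 𝟙 (dec-true (x ≟ x) ≡.refl) ⟨
    𝟙 (does (x ≟ x))                               ≤⟨ term≤sum _ (proj₂ x) ⟩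
    count (λ j → does ((proj₁ x , j) ≟ x))         ≤⟨ term≤sum _ (proj₁ x) ⟩
    ∑[ i < m ] count (λ j → does ((i , j) ≟ x))    ∎

-- Dense directed graphs on Fin n

module _ {n : ℕ} (E : Fin n → Fin n → Bool) where

  degree : Fin n → ℕ
  degree v = count (E v)

  edges : ℕ
  edges = ∑[ v < n ] degree v

  common? : (v w : Fin n) → Dec (∃ λ u → T (E w u) × T (E v u))
  common? v w = Fin.any? λ u → T? (E w u) ×-dec T? (E v u)

  Near : Fin n → Fin n → Bool
  Near v w = E v w ∨ does (common? v w)

  Near-sound : ∀ v w → T (Near v w) → T (E v w) ⊎ ∃ λ u → T (E w u) × T (E v u)
  Near-sound v w near with E v w | common? v w
  ... | true  | _            = inj₁ tt
  ... | false | yes (u , uv) = inj₂ (u , uv)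

edges-∧ : ∀ {n} (P Q : Fin n → Fin n → Bool) →
          edges P + edges Q ≤ edges (λ v u → P v u ∧ Q v u) + n * n
edges-∧ {n} P Q = begin
  edges P + edges Q                                      ≡⟨ ∑-distrib-+ (degree P) (degree Q) ⟨
  ∑[ v < n ] (degree P v + degree Q v)                   ≤⟨ sum-mono-≤ {n} (λ v → count-∧ (P v) (Q v)) ⟩
  ∑[ v < n ] (count (λ u → P v u ∧ Q v u) + n)           ≡⟨ ∑-distrib-+ (λ v → count (λ u → P v u ∧ Q v u)) (λ _ → n) ⟩
  edges (λ v u → P v u ∧ Q v u) + ∑[ v < n ] n           ≡⟨ cong (edges (λ v u → P v u ∧ Q v u) +_) (sum-const n n) ⟩
  edges (λ v u → P v u ∧ Q v u) + n * n                  ∎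
  where open ≤-Reasoning

dense⇒large-Near : ∀ {n} (E : Fin n → Fin n → Bool) →
                   5 * (n * n) < 9 * edges E → ∃ λ v → 2 * n < 3 * count (Near E v)
dense⇒large-Near {zero}  E ()
dense⇒large-Near {suc m} E dense =
  v₀ , [ (λ 2n<3d → <-≤-trans 2n<3d (*-monoʳ-≤ 3 (count-∨ˡ (E v₀) C)))
       , (λ 2n<3c → <-≤-trans 2n<3c (*-monoʳ-≤ 3 (count-∨ʳ (E v₀) C)))
       ]′ (cluster-bound {c = count C} (count-not C) dense edges≤nd edges-split)
  where
  n : ℕ
  n = suc m
  v₀ : Fin n
  v₀ = argmax (degree E) zero (allFin n)
  d : ℕ
  d = degree E v₀
  degree≤d : ∀ w → degree E w ≤ d
  degree≤d w = All.lookup (f[xs]≤f[argmax] {f = degree E} zero (allFin n)) (∈-allFin w)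
  C : Fin n → Bool
  C w = does (common? E v₀ w)
  edges≤nd : edges E ≤ n * d
  edges≤nd = ≤-trans (sum-mono-≤ degree≤d) (≤-reflexive (sum-const n d))
  split : ∀ w → degree E w + 𝟙 (not (C w)) * d ≤ 𝟙 (C w) * d + 𝟙 (not (C w)) * n
  split w = by-cases (common? E v₀ w)
    where
    by-cases : (c : Dec (∃ λ u → T (E w u) × T (E v₀ u))) →
               degree E w + 𝟙 (not (does c)) * d ≤ 𝟙 (does c) * d + 𝟙 (not (does c)) * n
    by-cases (yes _)      = +-monoˡ-≤ 0 (subst (degree E w ≤_) (≡.sym (+-identityʳ d)) (degree≤d w))
    by-cases (no ¬common) = subst₂ _≤_ (cong (degree E w +_) (≡.sym (+-identityʳ d))) (≡.sym (+-identityʳ n))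
                                   (count-disjoint (E w) (E v₀) ¬common)
  edges-split : edges E + count (not ∘ C) * d ≤ count C * d + count (not ∘ C) * n
  edges-split = begin
    edges E + count (not ∘ C) * d
      ≡⟨ cong (edges E +_) (count-*ʳ (not ∘ C) d) ⟨
    edges E + ∑[ w < n ] (𝟙 (not (C w)) * d)
      ≡⟨ ∑-distrib-+ (degree E) (λ w → 𝟙 (not (C w)) * d) ⟨
    ∑[ w < n ] (degree E w + 𝟙 (not (C w)) * d)
      ≤⟨ sum-mono-≤ {n} split ⟩
    ∑[ w < n ] (𝟙 (C w) * d + 𝟙 (not (C w)) * n)
      ≡⟨ ∑-distrib-+ (λ w → 𝟙 (C w) * d) (λ w → 𝟙 (not (C w)) * n) ⟩
    ∑[ w < n ] (𝟙 (C w) * d) + ∑[ w < n ] (𝟙 (not (C w)) * n)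
      ≡⟨ cong₂ _+_ (count-*ʳ C d) (count-*ʳ (not ∘ C) n) ⟩
    count C * d + count (not ∘ C) * n ∎
    where open ≤-Reasoning

-- The quotient G/H indexed by a transversal

module Transversal {c ℓ p} (G : Group c ℓ) (H : Pred (Group.Carrier G) p)
                   (H-normal : IsNormalSubgroup G H)
                   {n : ℕ} {X : Fin n → Group.Carrier G} (reps : IsCosetReps G H n X) where
  open Group G
  open GroupProperties G
  open IsNormalSubgroup H-normal using (subgroup; conj-closed)
  open IsSubgroup subgroup
  open IsCosetReps reps

  infix 4 _∼_
  _∼_ : Carrier → Carrier → Set p
  g ∼ h = H (g \\ h)

  ∼-isEquivalence : IsEquivalence _∼_
  ∼-isEquivalence = record
    { refl  = λ {g} → resp (sym (inverseˡ g)) ε∈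
    ; sym   = λ {g} {h} g∼h → resp (⁻¹-anti-homo-\\ g h) (⁻¹-closed g∼h)
    ; trans = λ {g} {h} {k} g∼h h∼k → resp (trans (assoc _ _ _) (∙-congˡ (\\-leftDividesˡ h k))) (∙-closed g∼h h∼k)
    }

  open IsEquivalence ∼-isEquivalence public using () renaming (refl to ∼-refl; sym to ∼-sym; trans to ∼-trans)
  ≈⇒∼ : ∀ {g h} → g ≈ h → g ∼ h
  ≈⇒∼ {g} g≈h = resp (\\-cong₂ refl g≈h) (∼-refl {g})

  ∼-∙ : ∀ {g g' h h'} → g ∼ g' → h ∼ h' → g ∙ h ∼ g' ∙ h'
  ∼-∙ {g} {g'} {h} {h'} g∼g' h∼h' = ∼-trans (resp right (conj-closed (h ⁻¹) g∼g')) (resp left h∼h')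
    where
    open SetoidReasoning setoid
    right : h ⁻¹ ∙ (g \\ g') ∙ h ⁻¹ ⁻¹ ≈ (g ∙ h) \\ (g' ∙ h)
    right = begin
      h ⁻¹ ∙ (g ⁻¹ ∙ g') ∙ h ⁻¹ ⁻¹   ≈⟨ ∙-congˡ (⁻¹-involutive h) ⟩
      h ⁻¹ ∙ (g ⁻¹ ∙ g') ∙ h         ≈⟨ ∙-congʳ (assoc _ _ _) ⟨
      h ⁻¹ ∙ g ⁻¹ ∙ g' ∙ h           ≈⟨ assoc _ _ _ ⟩
      h ⁻¹ ∙ g ⁻¹ ∙ (g' ∙ h)         ≈⟨ ∙-congʳ (⁻¹-anti-homo-∙ g h) ⟨
      (g ∙ h) ⁻¹ ∙ (g' ∙ h)          ∎
    left : h \\ h' ≈ (g' ∙ h) \\ (g' ∙ h')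
    left = begin
      h ⁻¹ ∙ h'                      ≈⟨ ∙-congˡ (\\-leftDividesʳ g' h') ⟨
      h ⁻¹ ∙ (g' ⁻¹ ∙ (g' ∙ h'))     ≈⟨ assoc _ _ _ ⟨
      h ⁻¹ ∙ g' ⁻¹ ∙ (g' ∙ h')       ≈⟨ ∙-congʳ (⁻¹-anti-homo-∙ g' h) ⟨
      (g' ∙ h) ⁻¹ ∙ (g' ∙ h')        ∎

  module ∼-Reasoning where
    open import Relation.Binary.Reasoning.Base.Single _∼_ ∼-refl ∼-trans public
    open ≈-syntax _IsRelatedTo_ _IsRelatedTo_ (λ g≈h → ∼-go (≈⇒∼ g≈h)) sym public

  ⌊_⌋ : Carrier → Fin n
  ⌊ g ⌋ = proj₁ (covers g)

  X⌊_⌋ : ∀ g → X ⌊ g ⌋ ∼ g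
  X⌊ g ⌋ = proj₂ (covers g)

  X-injective : ∀ {i j} → X i ∼ X j → i ≡ j
  X-injective = distinct _ _

  ⌊⌋-unique : ∀ {g i} → g ∼ X i → ⌊ g ⌋ ≡ i
  ⌊⌋-unique {g} g∼Xi = X-injective (∼-trans X⌊ g ⌋ g∼Xi)

  infixl 7 _·_
  _·_ : Fin n → Fin n → Fin n
  a · b = ⌊ X a ∙ X b ⌋

  X-· : ∀ a b → X (a · b) ∼ X a ∙ X b
  X-· a b = X⌊ X a ∙ X b ⌋

  ·-assoc : ∀ a b c → a · b · c ≡ a · (b · c)
  ·-assoc a b c = X-injective (begin
    X (a · b · c)         ∼⟨ X-· (a · b) c ⟩
    X (a · b) ∙ X c       ∼⟨ ∼-∙ (X-· a b) ∼-refl ⟩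
    X a ∙ X b ∙ X c       ≈⟨ assoc (X a) (X b) (X c) ⟩
    X a ∙ (X b ∙ X c)     ∼⟨ ∼-∙ ∼-refl (∼-sym (X-· b c)) ⟩
    X a ∙ X (b · c)       ∼⟨ ∼-sym (X-· a (b · c)) ⟩
    X (a · (b · c))       ∎)
    where open ∼-Reasoning

  infixl 7 _⧵_
  _⧵_ : Fin n → Fin n → Fin n
  v ⧵ u = ⌊ X v \\ X u ⌋

  ·-⧵ : ∀ v u → v · (v ⧵ u) ≡ u
  ·-⧵ v u = X-injective (begin
    X (v · (v ⧵ u))       ∼⟨ X-· v (v ⧵ u) ⟩
    X v ∙ X (v ⧵ u)       ∼⟨ ∼-∙ ∼-refl X⌊ X v \\ X u ⌋ ⟩
    X v ∙ (X v \\ X u)     ≈⟨ \\-leftDividesˡ (X v) (X u) ⟩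
    X u                   ∎)
    where open ∼-Reasoning

  ⧵-· : ∀ v y → v ⧵ (v · y) ≡ y
  ⧵-· v y = ⌊⌋-unique (begin
    X v \\ X (v · y)       ∼⟨ ∼-∙ ∼-refl (X-· v y) ⟩
    X v \\ (X v ∙ X y)     ≈⟨ \\-leftDividesʳ (X v) (X y) ⟩
    X y                   ∎)
    where open ∼-Reasoning

  translation : Fin n → Permutation n n
  translation v = permutation (v ·_) (v ⧵_) (·-⧵ v) (⧵-· v)

  e : Fin n
  e = ⌊ ε ⌋

  X-e : X e ∼ ε
  X-e = X⌊ ε ⌋

  e·e : e · e ≡ e
  e·e = X-injective (begin
    X (e · e)         ∼⟨ X-· e e ⟩
    X e ∙ X e         ∼⟨ ∼-∙ X-e X-e ⟩
    ε ∙ ε             ≈⟨ identityˡ ε ⟩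
    ε                 ∼⟨ ∼-sym X-e ⟩
    X e               ∎)
    where open ∼-Reasoning

  ∼⇒H-// : ∀ {g h} → g ∼ h → H (h // g)
  ∼⇒H-// {g} {h} g∼h = resp (∙-congʳ (\\-leftDividesˡ g h)) (conj-closed g g∼h)

  CarryFree : Fin n → Fin n → Set ℓ
  CarryFree a b = X a ∙ X b ≈ X (a · b)

  inImage⇒carryFree : ∀ a b → InImage G X (X a ∙ X b) → CarryFree a b
  inImage⇒carryFree a b (k , XaXb≈Xk) =
    trans XaXb≈Xk (reflexive (cong X (≡.sym (⌊⌋-unique (≈⇒∼ XaXb≈Xk)))))

  factor : Fin n → Fin n → Carrier
  factor a x = X (a · x) // X x

  factor∼X : ∀ a x → factor a x ∼ X a
  factor∼X a x = begin
    X (a · x) // X x        ∼⟨ ∼-∙ (X-· a x) ∼-refl ⟩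
    X a ∙ X x // X x        ≈⟨ //-rightDividesʳ (X x) (X a) ⟩
    X a                     ∎
    where open ∼-Reasoning

  factor-cocycle : ∀ a b x → factor a (b · x) ∙ factor b x ≈ factor (a · b) x
  factor-cocycle a b x = begin
    (X (a · (b · x)) // X (b · x)) ∙ (X (b · x) // X x)  ≈⟨ assoc _ _ _ ⟩
    X (a · (b · x)) ∙ (X (b · x) \\ (X (b · x) // X x))   ≈⟨ ∙-congˡ (\\-leftDividesʳ (X (b · x)) (X x ⁻¹)) ⟩
    X (a · (b · x)) // X x                               ≡⟨ cong (λ i → X i // X x) (·-assoc a b x) ⟨
    X (a · b · x) // X x                                 ∎
    where open SetoidReasoning setoid

  factor-carryFree : ∀ a v y → CarryFree v y → CarryFree (a · v) y → factor a (v · y) ≈ factor a v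
  factor-carryFree a v y vy avy = begin
    X (a · (v · y)) // X (v · y)                ≡⟨ cong (λ i → X i // X (v · y)) (·-assoc a v y) ⟨
    X (a · v · y) // X (v · y)                  ≈⟨ //-cong₂ avy vy ⟨
    X (a · v) ∙ X y // (X v ∙ X y)              ≈⟨ ∙-congˡ (⁻¹-anti-homo-∙ (X v) (X y)) ⟩
    X (a · v) ∙ X y ∙ (X y ⁻¹ ∙ X v ⁻¹)         ≈⟨ assoc _ _ _ ⟩
    X (a · v) ∙ (X y ∙ (X y \\ X v ⁻¹))          ≈⟨ ∙-congˡ (\\-leftDividesˡ (X y) (X v ⁻¹)) ⟩
    X (a · v) // X v                            ∎
    where open SetoidReasoning setoid

module Complement {c ℓ p} (G : Group c ℓ) (H : Pred (Group.Carrier G) p)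
                  (H-normal : IsNormalSubgroup G H)
                  {n : ℕ} {X : Fin n → Group.Carrier G} (reps : IsCosetReps G H n X)
                  {S : List (Fin n × Fin n)} (S-unique : Unique S)
                  (S-carryFree : All (λ ab → InImage G X (Group._∙_ G (X (proj₁ ab)) (X (proj₂ ab)))) S)
                  (S-large : 7 * (n * n) < 9 * length S) where
  open Group G
  open GroupProperties G using (identityʳ-unique; inverseʳ-unique; ε⁻¹≈ε; //-rightDividesˡ)
  open IsNormalSubgroup H-normal using (subgroup)
  open IsSubgroup subgroup using (resp)
  open Transversal G H H-normal reps

  inS : Fin n → Fin n → Bool
  inS a b = does ((a , b) ∈? S)

  inS⇒carryFree : ∀ a b → T (inS a b) → CarryFree a b
  inS⇒carryFree a b with (a , b) ∈? S
  ... | yes ab∈S = λ _ → inImage⇒carryFree a b (All.lookup S-carryFree ab∈S)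
  ... | no _     = λ ()

  Agree : Fin n → Fin n → Fin n → Bool
  Agree a v u = inS v (v ⧵ u) ∧ inS (a · v) (v ⧵ u)

  Agree⇒factor≈ : ∀ a v u → T (Agree a v u) → factor a u ≈ factor a v
  Agree⇒factor≈ a v u agree = trans (reflexive (cong (factor a) (≡.sym (·-⧵ v u))))
    (factor-carryFree a v (v ⧵ u) (inS⇒carryFree v (v ⧵ u) (proj₁ certified))
                                  (inS⇒carryFree (a · v) (v ⧵ u) (proj₂ certified)))
    where
    certified : T (inS v (v ⧵ u)) × T (inS (a · v) (v ⧵ u))
    certified = Equivalence.to (T-∧ {inS v (v ⧵ u)} {inS (a · v) (v ⧵ u)}) agree

  -- Opaque so that the conversion checker never unfolds this large proof term.
  opaque
    Agree-dense : ∀ a → 5 * (n * n) < 9 * edges (Agree a)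
    Agree-dense a = 7/9-twice⇒5/9 {L = length S} {edges (Agree a)} S-large (begin
      length S + length S
        ≤⟨ +-mono-≤ (length≤count-∈ S-unique) (length≤count-∈ S-unique) ⟩
      edges inS + edges inS
        ≡⟨ cong₂ _+_ untranslate-second untranslate-both ⟨
      edges (λ v u → inS v (v ⧵ u)) + edges (λ v u → inS (a · v) (v ⧵ u))
        ≤⟨ edges-∧ (λ v u → inS v (v ⧵ u)) (λ v u → inS (a · v) (v ⧵ u)) ⟩
      edges (Agree a) + n * n ∎)
      where
      open ≤-Reasoning
      untranslate-second : edges (λ v u → inS v (v ⧵ u)) ≡ edges inS
      untranslate-second = sum-cong-≗ {n} (λ v → count-permute (inS v) (flip (translation v)))
      untranslate-both : edges (λ v u → inS (a · v) (v ⧵ u)) ≡ edges inS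
      untranslate-both = ≡.trans (sum-cong-≗ {n} (λ v → count-permute (inS (a · v)) (flip (translation v))))
                                 (≡.sym (sum-permute (degree inS) (translation a)))

  centre : Fin n → Fin n
  centre a = proj₁ (dense⇒large-Near (Agree a) (Agree-dense a))

  Cluster : Fin n → Fin n → Bool
  Cluster a = Near (Agree a) (centre a)

  Cluster-large : ∀ a → 2 * n < 3 * count (Cluster a)
  Cluster-large a = proj₂ (dense⇒large-Near (Agree a) (Agree-dense a))

  section : Fin n → Carrier
  section a = factor a (centre a)

  factor≈section : ∀ a w → T (Cluster a w) → factor a w ≈ section a
  factor≈section a w w∈Cluster =
    [ Agree⇒factor≈ a (centre a) w
    , (λ { (u , agree , agree′) → trans (sym (Agree⇒factor≈ a w u agree)) (Agree⇒factor≈ a (centre a) u agree′) })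
    ]′ (Near-sound (Agree a) (centre a) w w∈Cluster)

  section-hom : ∀ a b → section a ∙ section b ≈ section (a · b)
  section-hom a b = via (large-subsets-meet (Cluster b) (Cluster a ∘ (b ·_)) (Cluster (a · b))
                            (Cluster-large b) bx-large (Cluster-large (a · b)))
    where
    bx-large : 2 * n < 3 * count (Cluster a ∘ (b ·_))
    bx-large = subst (λ k → 2 * n < 3 * k) (≡.sym (count-permute (Cluster a) (translation b))) (Cluster-large a)
    via : (∃ λ x → T (Cluster b x) × T (Cluster a (b · x)) × T (Cluster (a · b) x)) →
          section a ∙ section b ≈ section (a · b)
    via (x , x∈b , bx∈a , x∈ab) = begin
      section a ∙ section b           ≈⟨ ∙-cong (factor≈section a (b · x) bx∈a) (factor≈section b x x∈b) ⟨
      factor a (b · x) ∙ factor b x   ≈⟨ factor-cocycle a b x ⟩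
      factor (a · b) x                ≈⟨ factor≈section (a · b) x x∈ab ⟩
      section (a · b)                 ∎
      where open SetoidReasoning setoid

  section-e : section e ≈ ε
  section-e = identityʳ-unique (section e) (section e)
    (trans (section-hom e e) (reflexive (cong section e·e)))

  section-⁻¹ : ∀ a → section (a ⧵ e) ≈ section a ⁻¹
  section-⁻¹ a = inverseʳ-unique (section a) (section (a ⧵ e))
    (trans (section-hom a (a ⧵ e)) (trans (reflexive (cong section (·-⧵ a e))) section-e))

  section∈H⇒≡e : ∀ {a} → H (section a) → a ≡ e
  section∈H⇒≡e {a} sa∈H = X-injective (begin
    X a                    ∼⟨ ∼-sym (factor∼X a (centre a)) ⟩
    section a              ∼⟨ ∼-sym ε∼sa ⟩
    ε                      ∼⟨ ∼-sym X-e ⟩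
    X e                    ∎)
    where
    open ∼-Reasoning
    ε∼sa : ε ∼ section a
    ε∼sa = resp (sym (trans (∙-congʳ ε⁻¹≈ε) (identityˡ (section a)))) sa∈H

  K : Pred Carrier (c ⊔ ℓ ⊔ p)
  K g = Lift (c ⊔ p) (∃ λ a → g ≈ section a)

  K-subgroup : IsSubgroup G K
  K-subgroup = record
    { resp      = λ { g≈h (lift (a , g≈sa)) → lift (a , trans (sym g≈h) g≈sa) }
    ; ε∈        = lift (e , sym section-e)
    ; ∙-closed  = λ { (lift (a , g≈sa)) (lift (b , h≈sb)) → lift (a · b , trans (∙-cong g≈sa h≈sb) (section-hom a b)) }
    ; ⁻¹-closed = λ { (lift (a , g≈sa)) → lift (a ⧵ e , trans (⁻¹-cong g≈sa) (sym (section-⁻¹ a))) }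
    }

  K-complement : IsComplement G H K
  K-complement = record
    { subgroup = K-subgroup
    ; HK=G     = λ g → g // section ⌊ g ⌋ , section ⌊ g ⌋ , H-part g , lift (⌊ g ⌋ , refl) ,
                       sym (//-rightDividesˡ (section ⌊ g ⌋) g)
    ; H∩K=1    = λ { g g∈H (lift (a , g≈sa)) → begin
                     g           ≈⟨ g≈sa ⟩
                     section a   ≡⟨ cong section (section∈H⇒≡e (resp g≈sa g∈H)) ⟩
                     section e   ≈⟨ section-e ⟩
                     ε           ∎ }
    }
    where
    open SetoidReasoning setoid
    H-part : ∀ g → H (g // section ⌊ g ⌋)
    H-part g = ∼⇒H-// (∼-trans (factor∼X ⌊ g ⌋ (centre ⌊ g ⌋)) X⌊ g ⌋)

theorem1p1 : ∀ {c ℓ p} (G : Group c ℓ) (H : Pred (Group.Carrier G) p)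
    → IsNormalSubgroup G H
    → (n : ℕ) (X : Fin n → Group.Carrier G)
    → IsCosetReps G H n X
    → CarryFreeAbove7/9 G X
    → Σ (Pred (Group.Carrier G) (c ⊔ ℓ ⊔ p)) λ K → IsComplement G H K
theorem1p1 G H H-normal n X reps (S , S-unique , S-carryFree , S-large) = K , K-complement
  where open Complement G H H-normal reps S-unique S-carryFree S-large
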